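{- Consider an instance of fault-tolerant matroid median (context below) and an optimal solution $(x,y)$ of its natural LP relaxation, after the facility-splitting normalization described in the context, with the associated quantities $d_{\mathsf{max}}(j)$, $d_{\mathsf{av}}(j)$, $d_{\mathsf{av}}^r(j)$. Fix $\delta>0$ and $\gamma=3+\delta$, let $D$ be the set of dangerous clients and $D'\subseteq D$ the filtered set of dangerous clients (as defined in the context). Then for any two distinct clients $j\neq j'$ in $D'$, \[ d(j,j')\;\geq\;\max\{d_{\mathsf{max}}(j),d_{\mathsf{max}}(j')\}-\gamma^{ -1}\cdot\min\{d_{\mathsf{max}}(j),d_{\mathsf{max}}(j')\}. \]
   Context: Fault-tolerant matroid median: given clients $\mathcal{C}$, facilities $\mathcal{F}$, a finite metric $d$ on $\mathcal{C}\cup\mathcal{F}$, a matroid $\mathcal{M}=(\mathcal{F},\mathcal{I})$ with rank function $r_\mathcal{M}$, opening costs $f_i\ge 0$ and a requirement $r\in\mathbb{Z}_+$. The natural LP relaxation is: minimize $\sum_{i}f_iy_i+\sum_{j}\sum_i x_{ij}d(i,j)$ subject to $\sum_{i\in\mathcal{F}}x_{ij}=r$ for all $j\in\mathcal{C}$, $0\le x_{ij}\le y_i\le 1$ for all $i,j$, and $\sum_{i\in S}y_i\le r_\mathcal{M}(S)$ for all $S\subseteq\mathcal{F}$. Fix an optimal solution $(x,y)$. By splitting each facility into co-located copies (each copy at distance $0$ from the original and its other copies, with the $y$-value split among copies and the matroid replaced by one on the set $\mathcal{F}'$ of copies with the same rank on corresponding sets), assume $x_{ij}\in\{0,y_i\}$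 for all $i\in\mathcal{F}'$, $j\in\mathcal{C}$. For $S\subseteq\mathcal{F}'$ write $y(S)=\sum_{i\in S}y_i$. Let $\mathcal{F}_j=\{i\in\mathcal{F}':x_{ij}>0\}$, so $y(\mathcal{F}_j)=r$, and (using further co-located copies) partition $\mathcal{F}_j=\bigcup_{t\in[r]}\mathcal{F}_{j,t}$ with $y(\mathcal{F}_{j,t})=1$ and every facility of $\mathcal{F}_{j,t_1}$ no farther from $j$ than every facility of $\mathcal{F}_{j,t_2}$ whenever $t_1<t_2$. Define $d_{\mathsf{av}}^t(j)=\sum_{i\in\mathcal{F}_{j,t}}y_id(i,j)$, $d_{\mathsf{av}}(j)=r^{ -1}\sum_{i\in\mathcal{F}_j}y_id(i,j)$, and $d_{\mathsf{max}}(j)=\max_{i\in\mathcal{F}_{j,r}}d(i,j)$. Fix $\gamma=3+\delta$ with $\delta>0$. A client $j$ is dangerous if $d_{\mathsf{max}}(j)>3\gamma\, d_{\mathsf{av}}^r(j)$; let $D$ be the set of dangerous clients. Two dangerous clients $j,j'$ are in conflict if $d(j,j')\le 6\max\{d_{\mathsf{av}}(j),d_{\mathsf{av}}(j')\}$. The set $D'$ is built as follows: start with $D'=\emptyset$ and all of $D$ unmarked; process clients of $D$ in non-decreasing order of $d_{\mathsf{av}}$, and whenever the current client $j$ is unmarked, add $j$ to $D'$ and mark every $j'\in D$ in conflict with $j$ (including $j$ itself).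
   Formalization: The distances $d$, the opening costs $f_i$, the LP solution $(x,y)$ and $\delta$ are rational, and optimality of $(x,y)$ is taken among rational feasible solutions. -}

module Defs where

open import Data.Nat as ℕ using (ℕ; zero; suc)
open import Data.Integer using (+_)
open import Data.Rational
  using (ℚ; 0ℚ; positive; 1ℚ; _+_; _*_; _-_; _≤_; _<_; _≤ᵇ_; _⊔_; _/_; 1/_; Positive; NonNegative)
open import Data.Rational.Properties using (pos+pos⇒pos; pos⇒nonZero)
open import Data.Bool using (Bool; true; false; if_then_else_; not; _∧_; _∨_)
open import Data.Fin as Fin using (Fin)
open import Data.Fin.Subset as Sub using (Subset; ⁅_⁆; _∪_; ∣_∣; _∉_; _⊆_)
open import Data.Vec using (lookup)
open import Data.Sum using (_⊎_; inj₁; inj₂)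
open import Data.Product using (_×_; ∃; _,_)
open import Data.List using (List; []; _∷_)
open import Data.Bool.ListAction using (any)
open import Relation.Binary.PropositionalEquality using (_≡_)
open import Relation.Nullary.Decidable using (⌊_⌋)

sumF : {n : ℕ} → (Fin n → ℚ) → ℚ
sumF {zero}  g = 0ℚ
sumF {suc n} g = g Fin.zero + sumF (λ i → g (Fin.suc i))

-- maximum of a nonnegative function over Fin n (0 for n = 0)
maxF : {n : ℕ} → (Fin n → ℚ) → ℚ
maxF {zero}  g = 0ℚ
maxF {suc n} g = g Fin.zero ⊔ maxF (λ i → g (Fin.suc i))

ℕ→ℚ : ℕ → ℚ
ℕ→ℚ n = (+ n) / 1

record Matroid (n : ℕ) : Set₁ where
  field
    Indep    : Subset n → Set
    indep-⊥  : Indep Sub.⊥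
    indep-⊆  : ∀ {A B} → A ⊆ B → Indep B → Indep A
    exchange : ∀ {A B} → Indep A → Indep B → ∣ A ∣ ℕ.< ∣ B ∣ →
               ∃ λ e → e Sub.∈ B × e ∉ A × Indep (A ∪ ⁅ e ⁆)

IsRank : {n : ℕ} → Matroid n → Subset n → ℕ → Set
IsRank M S k =
  (∃ λ I → I ⊆ S × Matroid.Indep M I × ∣ I ∣ ≡ k) ×
  (∀ I → I ⊆ S → Matroid.Indep M I → ∣ I ∣ ℕ.≤ k)

-- The distance is a finite (pseudo)metric: co-located copies are at distance 0.
-- The requirement is r = suc k (r ≥ 1).

record Instance : Set₁ where
  field
    nC nF   : ℕ
    d       : Fin nC ⊎ Fin nF → Fin nC ⊎ Fin nF → ℚ
    d-refl  : ∀ p → d p p ≡ 0ℚ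
    d-nonneg : ∀ p q → 0ℚ ≤ d p q
    d-sym   : ∀ p q → d p q ≡ d q p
    d-tri   : ∀ p q s → d p s ≤ d p q + d q s
    M       : Matroid nF
    f       : Fin nF → ℚ
    f-nonneg : ∀ i → 0ℚ ≤ f i
    k       : ℕ

  r : ℕ
  r = suc k

module _ (I : Instance) where
  open Instance I

  dist : Fin nF → Fin nC → ℚ
  dist i j = d (inj₂ i) (inj₁ j)

  dCC : Fin nC → Fin nC → ℚ
  dCC j j' = d (inj₁ j) (inj₁ j')

  ySum : (Fin nF → ℚ) → Subset nF → ℚ
  ySum y S = sumF (λ i → if lookup S i then y i else 0ℚ)

  -- x j i stands for x_{ij}
  Feasible : (Fin nC → Fin nF → ℚ) → (Fin nF → ℚ) → Set
  Feasible x y =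
    (∀ j → sumF (x j) ≡ ℕ→ℚ r) ×
    (∀ j i → 0ℚ ≤ x j i) ×
    (∀ j i → x j i ≤ y i) ×
    (∀ i → 0ℚ ≤ y i) ×
    (∀ i → y i ≤ 1ℚ) ×
    (∀ S m → IsRank M S m → ySum y S ≤ ℕ→ℚ m)

  cost : (Fin nC → Fin nF → ℚ) → (Fin nF → ℚ) → ℚ
  cost x y = sumF (λ i → f i * y i) + sumF (λ j → sumF (λ i → x j i * dist i j))

  Optimal : (Fin nC → Fin nF → ℚ) → (Fin nF → ℚ) → Set
  Optimal x y = Feasible x y ×
    (∀ x' y' → Feasible x' y' → cost x y ≤ cost x' y')

  -- Data fixed after the normalisation: x, y and the block assignment
  -- blk j i ∈ Fin r (meaningful for i ∈ F_j): F_{j,t} = {i ∈ F_j | blk j i = t}.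
  module Quantities (x : Fin nC → Fin nF → ℚ) (y : Fin nF → ℚ)
                    (blk : Fin nC → Fin nF → Fin r) where

    inF : Fin nC → Fin nF → Bool
    inF j i = not (x j i ≤ᵇ 0ℚ)

    inBlock : Fin nC → Fin r → Fin nF → Bool
    inBlock j t i = inF j i ∧ ⌊ blk j i Fin.≟ t ⌋

    lastBlock : Fin r
    lastBlock = Fin.fromℕ k

    ValidBlocks : Set
    ValidBlocks =
      (∀ j t → sumF (λ i → if inBlock j t i then y i else 0ℚ) ≡ 1ℚ) ×
      (∀ j i i' → inF j i ≡ true → inF j i' ≡ true →
         blk j i Fin.< blk j i' → dist i j ≤ dist i' j)

    davT : Fin nC → Fin r → ℚ
    davT j t = sumF (λ i → if inBlock j t i then y i * dist i j else 0ℚ)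

    dav : Fin nC → ℚ
    dav j = ((+ 1) / r) * sumF (λ i → if inF j i then y i * dist i j else 0ℚ)

    -- max over F_{j,r} (distances are ≥ 0 and F_{j,r} is nonempty)
    dmax : Fin nC → ℚ
    dmax j = maxF (λ i → if inBlock j lastBlock i then dist i j else 0ℚ)

    module Filter (δ : ℚ) where

      γ : ℚ
      γ = ℕ→ℚ 3 + δ

      dangerous : Fin nC → Bool
      dangerous j = not (dmax j ≤ᵇ (ℕ→ℚ 3 * γ) * davT j lastBlock)

      conflict : Fin nC → Fin nC → Bool
      conflict j j' = dCC j j' ≤ᵇ ℕ→ℚ 6 * (dav j ⊔ dav j')

      -- A client is
      -- unmarked at its turn iff it is in conflict with no previously
      -- selected client (marks are exactly conflicts with selected ones).
      greedy : List (Fin nC) → List (Fin nC) → List (Fin nC)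
      greedy sel []       = sel
      greedy sel (j ∷ js) =
        if any (conflict j) sel then greedy sel js else greedy (j ∷ sel) js

      D' : List (Fin nC) → List (Fin nC)
      D' order = greedy [] order

γ⁻¹ : (δ : ℚ) → 0ℚ < δ → ℚ
γ⁻¹ δ h = 1/_ γ {{pos⇒nonZero γ {{pos+pos⇒pos (ℕ→ℚ 3) δ {{positive h}}}}}}
  where
  γ : ℚ
  γ = ℕ→ℚ 3 + δ

{-# OPTIONS --safe #-}
-- Let j, j′ be two clients kept by the filter: both are dangerous and they are not in conflict,
-- so D = d(j,j′) > 6·max(d_av(j), d_av(j′)).  It suffices to show d_max(j) − d_max(j′)/γ ≤ D
-- for both orders of j and j′.  Suppose D + τ < d_max(j) with τ = d_max(j′)/γ.  An optimal LP
-- solution never leaves a facility i with y_i > 0 unused by j while j uses a farther one (moving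
-- mass onto i would be cheaper), and j uses a facility at distance d_max(j); so every facility
-- of F_{j′} within τ of j′ is shared with j.  Each shared facility i contributes at least D·y_i to
-- r·d_av(j) + r·d_av(j′) < r·D/3, so the shared mass is below r/3.  But j′ is dangerous, so
-- 3·d_av^r(j′) < τ: the blocks before the last lie within τ of j′, and by Markov's inequality
-- the last block has mass below 1/3 beyond τ.  Hence the shared mass exceeds r − 1/3 ≥ 2r/3.
module Submission where

open import Defs
open import Data.Rational using (ℚ; 0ℚ; _≤_; _<_; _-_; _*_; _⊔_; _⊓_)
open import Data.Fin using (Fin)
open import Data.Bool using (true)
open import Data.Sum using (_⊎_)
open import Data.Product using (_×_)
open import Data.List using (List)
open import Data.List.Membership.Propositional using (_∈_)
open import Data.List.Relation.Unary.Unique.Propositional using (Unique)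
open import Data.List.Relation.Unary.AllPairs using (AllPairs)
open import Relation.Binary.PropositionalEquality using (_≡_; _≢_)

open import Algebra.Bundles using (CommutativeMonoid)
open import Data.Bool using (Bool; false; if_then_else_; not; _∧_; T)
open import Data.Bool.Properties using (∧-conicalˡ; ∧-conicalʳ; not-injective)
open import Data.Bool.ListAction using (any)
open import Data.Empty using (⊥; ⊥-elim)
import Data.Fin as Fin
open import Data.Fin using (zero; suc; _≟_)
open import Data.Fin.Properties using (≤fromℕ; ≤∧≢⇒<)
import Data.Integer as ℤ
open import Data.List using ([]; _∷_)
open import Data.List.Relation.Unary.All as All using ([]; _∷_)
open import Data.List.Relation.Unary.All.Properties using (¬Any⇒All¬)
open import Data.List.Relation.Unary.AllPairs using ([]; _∷_)
open import Data.List.Relation.Unary.Any using (here; there)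
open import Data.List.Relation.Unary.Any.Properties using (any⁺)
open import Data.Nat using (ℕ; s≤s; z≤n)
import Data.Nat.Coprimality as Coprime
open import Data.Product using (∃; _,_; proj₁; proj₂)
open import Data.Rational
  using (Positive; 1ℚ; mkℚ; -_; _+_; _/_; _≤ᵇ_; nonNegative; positive; *≤*)
open import Data.Rational.Properties hiding (_≟_)
open import Data.Rational.Solver using (module +-*-Solver)
import Data.Sum as Sum
open import Data.Sum using (inj₁; inj₂)
open import Data.Unit using (tt)
open import Function using (_∘_)
open import Relation.Binary.Definitions using (Symmetric)
open import Relation.Binary.PropositionalEquality
  using (refl; sym; trans; cong; cong₂; subst; module ≡-Reasoning)
open import Relation.Nullary using (¬_; yes; no; does)
open import Relation.Nullary.Decidable using (toWitness)

open import Algebra.Properties.CommutativeSemigroup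
  (CommutativeMonoid.commutativeSemigroup +-0-commutativeMonoid) using (interchange)
open +-*-Solver

*-nonneg : ∀ {p q} → 0ℚ ≤ p → 0ℚ ≤ q → 0ℚ ≤ p * q
*-nonneg {p} {q} 0≤p 0≤q =
  nonNegative⁻¹ _ {{nonNeg*nonNeg⇒nonNeg p {{nonNegative 0≤p}} q {{nonNegative 0≤q}}}}

+-nonneg : ∀ {p q} → 0ℚ ≤ p → 0ℚ ≤ q → 0ℚ ≤ p + q
+-nonneg {p} {q} 0≤p 0≤q =
  nonNegative⁻¹ _ {{nonNeg+nonNeg⇒nonNeg p {{nonNegative 0≤p}} q {{nonNegative 0≤q}}}}

*-monoˡ-≤-0≤ : ∀ {c p q} → 0ℚ ≤ c → p ≤ q → c * p ≤ c * q
*-monoˡ-≤-0≤ {c} 0≤c = *-monoˡ-≤-nonNeg c {{nonNegative 0≤c}}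

*-monoʳ-≤-0≤ : ∀ {c p q} → 0ℚ ≤ c → p ≤ q → p * c ≤ q * c
*-monoʳ-≤-0≤ {c} 0≤c = *-monoʳ-≤-nonNeg c {{nonNegative 0≤c}}

*-monoˡ-<-0< : ∀ {c p q} → 0ℚ < c → p < q → c * p < c * q
*-monoˡ-<-0< {c} 0<c = *-monoʳ-<-pos c {{positive 0<c}}

*-monoʳ-<-0< : ∀ {c p q} → 0ℚ < c → p < q → p * c < q * c
*-monoʳ-<-0< {c} 0<c = *-monoˡ-<-pos c {{positive 0<c}}

p<q⇒p-q<0 : ∀ {p q} → p < q → p - q < 0ℚ
p<q⇒p-q<0 {p} {q} p<q = <-≤-trans (+-monoˡ-< (- q) p<q) (≤-reflexive (+-inverseʳ q))

p<q-r⇒r+p<q : ∀ {p q r} → p < q - r → r + p < q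
p<q-r⇒r+p<q {p} {q} {r} p<q-r = begin-strict
  r + p       <⟨ +-monoʳ-< r p<q-r ⟩
  r + (q - r) ≡⟨ solve 2 (λ q r → r :+ (q :- r) := q) refl q r ⟩
  q           ∎
  where open ≤-Reasoning

≤ᵇ≡true⇒≤ : ∀ {p q} → (p ≤ᵇ q) ≡ true → p ≤ q
≤ᵇ≡true⇒≤ p≤ᵇq = ≤ᵇ⇒≤ (subst T (sym p≤ᵇq) tt)

≤ᵇ≡false⇒> : ∀ {p q} → (p ≤ᵇ q) ≡ false → q < p
≤ᵇ≡false⇒> p≰ᵇq = ≰⇒> (λ p≤q → subst T p≰ᵇq (≤⇒≤ᵇ p≤q))

0≤ℕ→ℚ : ∀ n → 0ℚ ≤ ℕ→ℚ n
0≤ℕ→ℚ n = nonNegative⁻¹ (ℕ→ℚ n) {{normalize-nonNeg n 1}}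

0≤p⇒p≤3p : ∀ {p} → 0ℚ ≤ p → p ≤ ℕ→ℚ 3 * p
0≤p⇒p≤3p {p} 0≤p =
  ≤-trans (≤-reflexive (sym (*-identityˡ p))) (*-monoʳ-≤-0≤ 0≤p (≤ᵇ⇒≤ {1ℚ} {ℕ→ℚ 3} tt))

ℕ→ℚ-suc : ∀ k →
  ℕ→ℚ (ℕ.suc k) ≡ mkℚ (ℤ.+ ℕ.suc k) 0 (Coprime.sym (Coprime.1-coprimeTo (ℕ.suc k)))
ℕ→ℚ-suc k = normalize-coprime (Coprime.sym (Coprime.1-coprimeTo (ℕ.suc k)))

ℕ→ℚ-suc*1/suc : ∀ k → ℕ→ℚ (ℕ.suc k) * ((ℤ.+ 1) / ℕ.suc k) ≡ 1ℚ
ℕ→ℚ-suc*1/suc k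
  rewrite ℕ→ℚ-suc k | normalize-coprime {1} {k} (Coprime.1-coprimeTo (ℕ.suc k))
  = *-inverseʳ (mkℚ (ℤ.+ ℕ.suc k) 0 (Coprime.sym (Coprime.1-coprimeTo (ℕ.suc k))))

1≤ℕ→ℚ-suc : ∀ k → 1ℚ ≤ ℕ→ℚ (ℕ.suc k)
1≤ℕ→ℚ-suc k rewrite ℕ→ℚ-suc k = *≤* (ℤ.+≤+ (s≤s z≤n))

τb≤T∧3T<τ⇒3b<1 : ∀ {τ b T} → 0ℚ ≤ τ → τ * b ≤ T → ℕ→ℚ 3 * T < τ →
  ℕ→ℚ 3 * b < 1ℚ
τb≤T∧3T<τ⇒3b<1 {τ} {b} {T} 0≤τ τb≤T 3T<τ =
  *-cancelˡ-<-nonNeg τ {{nonNegative 0≤τ}} (begin-strict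
    τ * (ℕ→ℚ 3 * b) ≡⟨ solve 3 (λ τ t b → τ :* (t :* b) := t :* (τ :* b)) refl τ (ℕ→ℚ 3) b ⟩
    ℕ→ℚ 3 * (τ * b) ≤⟨ *-monoˡ-≤-0≤ (0≤ℕ→ℚ 3) τb≤T ⟩
    ℕ→ℚ 3 * T       <⟨ 3T<τ ⟩
    τ               ≡⟨ *-identityʳ τ ⟨
    τ * 1ℚ          ∎)
  where open ≤-Reasoning

mass-budget-contradiction : ∀ {R D M s b} → 1ℚ ≤ R → 0ℚ ≤ M → ℕ→ℚ 6 * M < D →
  R ≤ s + b → ℕ→ℚ 3 * b < 1ℚ → D * s ≤ R * M + R * M → ⊥
mass-budget-contradiction {R} {D} {M} {s} {b} 1≤R 0≤M 6M<D R≤s+b 3b<1 Ds≤2RM =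
  <-irrefl refl (begin-strict
    ℕ→ℚ 3 * (R * D)
      ≤⟨ *-monoˡ-≤-0≤ (0≤ℕ→ℚ 3) (*-monoʳ-≤-0≤ 0≤D R≤s+b) ⟩
    ℕ→ℚ 3 * ((s + b) * D)
      ≡⟨ solve 4 (λ t s b D → t :* ((s :+ b) :* D) := t :* (D :* s) :+ (t :* b) :* D)
                 refl (ℕ→ℚ 3) s b D ⟩
    ℕ→ℚ 3 * (D * s) + ℕ→ℚ 3 * b * D
      <⟨ +-monoʳ-< (ℕ→ℚ 3 * (D * s)) (*-monoʳ-<-0< 0<D 3b<1) ⟩
    ℕ→ℚ 3 * (D * s) + 1ℚ * D
      ≤⟨ +-monoˡ-≤ (1ℚ * D) (*-monoˡ-≤-0≤ (0≤ℕ→ℚ 3) Ds≤2RM) ⟩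
    ℕ→ℚ 3 * (R * M + R * M) + 1ℚ * D
      ≡⟨ solve 4 (λ t R M D → t :* (R :* M :+ R :* M) :+ con 1ℚ :* D := R :* ((t :+ t) :* M) :+ D)
                 refl (ℕ→ℚ 3) R M D ⟩
    R * (ℕ→ℚ 6 * M) + D
      ≤⟨ +-monoˡ-≤ D (*-monoˡ-≤-0≤ 0≤R (<⇒≤ 6M<D)) ⟩
    R * D + D
      ≤⟨ +-monoʳ-≤ (R * D) D≤RD ⟩
    R * D + R * D
      ≡⟨ +-identityʳ _ ⟨
    R * D + R * D + 0ℚ
      ≤⟨ +-monoʳ-≤ (R * D + R * D) (*-nonneg 0≤R 0≤D) ⟩
    R * D + R * D + R * D
      ≡⟨ solve 1 (λ X → X :+ X :+ X := con (ℕ→ℚ 3) :* X) refl (R * D) ⟩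
    ℕ→ℚ 3 * (R * D) ∎)
  where
  open ≤-Reasoning
  0≤R : 0ℚ ≤ R
  0≤R = ≤-trans (≤ᵇ⇒≤ {0ℚ} {1ℚ} tt) 1≤R
  0<D : 0ℚ < D
  0<D = ≤-<-trans (*-nonneg (0≤ℕ→ℚ 6) 0≤M) 6M<D
  0≤D : 0ℚ ≤ D
  0≤D = <⇒≤ 0<D
  D≤RD : D ≤ R * D
  D≤RD = ≤-trans (≤-reflexive (sym (*-identityˡ D))) (*-monoʳ-≤-0≤ 0≤D 1≤R)

⊔-minus-⊓-≤ : ∀ g p q {c} → p - g * q ≤ c → q - g * p ≤ c → (p ⊔ q) - g * (p ⊓ q) ≤ c
⊔-minus-⊓-≤ g p q p-gq≤c q-gp≤c with ≤-total p q
... | inj₁ p≤q rewrite p≤q⇒p⊔q≡q p≤q | p≤q⇒p⊓q≡p p≤q = q-gp≤c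
... | inj₂ q≤p rewrite p≥q⇒p⊔q≡p q≤p | p≥q⇒p⊓q≡q q≤p = p-gq≤c

mask : ∀ {n} → (Fin n → Bool) → (Fin n → ℚ) → Fin n → ℚ
mask p g i = if p i then g i else 0ℚ

if-*ʳ : ∀ b {p q} → (if b then p else 0ℚ) * q ≡ (if b then p * q else 0ℚ)
if-*ʳ true          = refl
if-*ʳ false {q = q} = *-zeroˡ q

sumF-cong : ∀ {n} {g h : Fin n → ℚ} → (∀ i → g i ≡ h i) → sumF g ≡ sumF h
sumF-cong {ℕ.zero}  g≗h = refl
sumF-cong {ℕ.suc n} g≗h = cong₂ _+_ (g≗h zero) (sumF-cong (g≗h ∘ suc))

sumF-mono : ∀ {n} {g h : Fin n → ℚ} → (∀ i → g i ≤ h i) → sumF g ≤ sumF h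
sumF-mono {ℕ.zero}  g≤h = ≤-refl
sumF-mono {ℕ.suc n} g≤h = +-mono-≤ (g≤h zero) (sumF-mono (g≤h ∘ suc))

sumF-zero : ∀ n → sumF {n} (λ _ → 0ℚ) ≡ 0ℚ
sumF-zero ℕ.zero    = refl
sumF-zero (ℕ.suc n) = trans (+-identityˡ _) (sumF-zero n)

sumF-nonneg : ∀ {n} {g : Fin n → ℚ} → (∀ i → 0ℚ ≤ g i) → 0ℚ ≤ sumF g
sumF-nonneg {n} {g} 0≤g = subst (_≤ sumF g) (sumF-zero n) (sumF-mono 0≤g)

sumF-+ : ∀ {n} (g h : Fin n → ℚ) → sumF (λ i → g i + h i) ≡ sumF g + sumF h
sumF-+ {ℕ.zero}  g h = sym (+-identityˡ 0ℚ)
sumF-+ {ℕ.suc n} g h = trans (cong ((g zero + h zero) +_) (sumF-+ (g ∘ suc) (h ∘ suc)))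
                             (interchange (g zero) (h zero) _ _)

sumF-*ˡ : ∀ {n} c (g : Fin n → ℚ) → sumF (λ i → c * g i) ≡ c * sumF g
sumF-*ˡ {ℕ.zero}  c g = sym (*-zeroʳ c)
sumF-*ˡ {ℕ.suc n} c g = trans (cong (c * g zero +_) (sumF-*ˡ c (g ∘ suc)))
                              (sym (*-distribˡ-+ c _ _))

-- Unlike ⌊_⌋ (used in Defs), does computes here: does (suc i ≟ suc a) reduces to does (i ≟ a).
sumF-at : ∀ {n} (a : Fin n) (g : Fin n → ℚ) →
  sumF (λ i → if does (i ≟ a) then g i else 0ℚ) ≡ g a
sumF-at {ℕ.suc n} zero    g = trans (cong (g zero +_) (sumF-zero n)) (+-identityʳ (g zero))
sumF-at {ℕ.suc n} (suc a) g = trans (+-identityˡ _) (sumF-at a (g ∘ suc))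

maxF-attained : ∀ {n} (g : Fin n → ℚ) → maxF g ≡ 0ℚ ⊎ ∃ λ i → maxF g ≡ g i
maxF-attained {ℕ.zero}  g = inj₁ refl
maxF-attained {ℕ.suc n} g with ⊔-sel (g zero) (maxF (g ∘ suc)) | maxF-attained (g ∘ suc)
... | inj₁ max≡g₀ | _              = inj₂ (zero , max≡g₀)
... | inj₂ max≡ms | inj₁ ms≡0      = inj₁ (trans max≡ms ms≡0)
... | inj₂ max≡ms | inj₂ (i , ms≡) = inj₂ (suc i , trans max≡ms ms≡)

mask-nonneg : ∀ {n} p {w : Fin n → ℚ} → (∀ i → 0ℚ ≤ w i) → ∀ i → 0ℚ ≤ mask p w i
mask-nonneg p 0≤w i with p i
... | true  = 0≤w i
... | false = ≤-refl

sumF-mask-+ : ∀ {n} p (g h : Fin n → ℚ) →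
  sumF (mask p (λ i → g i + h i)) ≡ sumF (mask p g) + sumF (mask p h)
sumF-mask-+ p g h = trans (sumF-cong pointwise) (sumF-+ (mask p g) (mask p h))
  where
  pointwise : ∀ i → mask p (λ i → g i + h i) i ≡ mask p g i + mask p h i
  pointwise i with p i
  ... | true  = refl
  ... | false = sym (+-identityˡ 0ℚ)

sumF-mask-⊆ : ∀ {n} {p q : Fin n → Bool} {w : Fin n → ℚ} → (∀ i → 0ℚ ≤ w i) →
  (∀ i → p i ≡ true → q i ≡ true) → sumF (mask p w) ≤ sumF (mask q w)
sumF-mask-⊆ {p = p} {q} {w} 0≤w p⊆q = sumF-mono pointwise
  where
  pointwise : ∀ i → mask p w i ≤ mask q w i
  pointwise i with p i in pᵢ
  ... | false = mask-nonneg q 0≤w i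
  ... | true rewrite p⊆q i pᵢ = ≤-refl

sumF-mask-cover : ∀ {n} {p q s : Fin n → Bool} {w : Fin n → ℚ} → (∀ i → 0ℚ ≤ w i) →
  (∀ i → p i ≡ true → q i ≡ true ⊎ s i ≡ true) →
  sumF (mask p w) ≤ sumF (mask q w) + sumF (mask s w)
sumF-mask-cover {p = p} {q} {s} {w} 0≤w p⊆q∪s =
  ≤-trans (sumF-mono pointwise) (≤-reflexive (sumF-+ (mask q w) (mask s w)))
  where
  pointwise : ∀ i → mask p w i ≤ mask q w i + mask s w i
  pointwise i with p i in pᵢ
  ... | false = +-nonneg (mask-nonneg q 0≤w i) (mask-nonneg s 0≤w i)
  ... | true with p⊆q∪s i pᵢ
  ...   | inj₁ qᵢ rewrite qᵢ = ≤-trans (≤-reflexive (sym (+-identityʳ (w i))))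
                                       (+-monoʳ-≤ (w i) (mask-nonneg s 0≤w i))
  ...   | inj₂ sᵢ rewrite sᵢ = ≤-trans (≤-reflexive (sym (+-identityˡ (w i))))
                                       (+-monoˡ-≤ (w i) (mask-nonneg q 0≤w i))

sumF-mask-scale : ∀ {n} {p : Fin n → Bool} c (w : Fin n → ℚ) {h : Fin n → ℚ} →
  (∀ i → p i ≡ true → c * w i ≤ h i) → c * sumF (mask p w) ≤ sumF (mask p h)
sumF-mask-scale {p = p} c w {h} cw≤h =
  ≤-trans (≤-reflexive (sym (sumF-*ˡ c (mask p w)))) (sumF-mono pointwise)
  where
  pointwise : ∀ i → c * mask p w i ≤ mask p h i
  pointwise i with p i in pᵢ
  ... | true  = cw≤h i pᵢ
  ... | false = ≤-reflexive (*-zeroʳ c)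

allPairs-lookup : ∀ {A : Set} {R : A → A → Set} {xs a b} → Symmetric R → AllPairs R xs →
  a ∈ xs → b ∈ xs → a ≢ b → R a b
allPairs-lookup sym-R (_ ∷ _)   (here refl) (here refl) a≢b = ⊥-elim (a≢b refl)
allPairs-lookup sym-R (Rx ∷ _)  (here refl) (there b∈)  _   = All.lookup Rx b∈
allPairs-lookup sym-R (Rx ∷ _)  (there a∈)  (here refl) _   = sym-R (All.lookup Rx a∈)
allPairs-lookup sym-R (_ ∷ Rxs) (there a∈)  (there b∈)  a≢b = allPairs-lookup sym-R Rxs a∈ b∈ a≢b

transfer : ∀ {n} → Fin n → Fin n → ℚ → Fin n → ℚ
transfer i i′ ε k = (if does (k ≟ i) then ε else 0ℚ) + (if does (k ≟ i′) then - ε else 0ℚ)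

sumF-transfer : ∀ {n} (i i′ : Fin n) ε → sumF (transfer i i′ ε) ≡ 0ℚ
sumF-transfer i i′ ε = begin
  sumF (transfer i i′ ε)       ≡⟨ sumF-+ gainᵢ lossᵢ′ ⟩
  sumF gainᵢ + sumF lossᵢ′     ≡⟨ cong₂ _+_ (sumF-at i (λ _ → ε)) (sumF-at i′ (λ _ → - ε)) ⟩
  ε - ε                        ≡⟨ +-inverseʳ ε ⟩
  0ℚ                           ∎
  where
  open ≡-Reasoning
  gainᵢ lossᵢ′ : _ → ℚ
  gainᵢ  k = if does (k ≟ i) then ε else 0ℚ
  lossᵢ′ k = if does (k ≟ i′) then - ε else 0ℚ

sumF-transfer-* : ∀ {n} (i i′ : Fin n) ε (g : Fin n → ℚ) →
  sumF (λ k → transfer i i′ ε k * g k) ≡ ε * g i - ε * g i′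
sumF-transfer-* i i′ ε g = begin
  sumF (λ k → transfer i i′ ε k * g k)         ≡⟨ sumF-cong distrib ⟩
  sumF (λ k → gainᵢ k + lossᵢ′ k)              ≡⟨ sumF-+ gainᵢ lossᵢ′ ⟩
  sumF gainᵢ + sumF lossᵢ′                     ≡⟨ cong₂ _+_ (sumF-at i (λ k → ε * g k))
                                                            (sumF-at i′ (λ k → - ε * g k)) ⟩
  ε * g i + - ε * g i′                         ≡⟨ cong (ε * g i +_) (neg-distribˡ-* ε (g i′)) ⟨
  ε * g i - ε * g i′                           ∎
  where
  open ≡-Reasoning
  gainᵢ lossᵢ′ : _ → ℚ
  gainᵢ  k = if does (k ≟ i) then ε * g k else 0ℚ
  lossᵢ′ k = if does (k ≟ i′) then - ε * g k else 0ℚ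
  distrib : ∀ k → transfer i i′ ε k * g k ≡ gainᵢ k + lossᵢ′ k
  distrib k = trans (*-distribʳ-+ (g k) (if does (k ≟ i) then ε else 0ℚ)
                                        (if does (k ≟ i′) then - ε else 0ℚ))
                    (cong₂ _+_ (if-*ʳ (does (k ≟ i))) (if-*ʳ (does (k ≟ i′))))

module _ (I : Instance) where
  open Instance I

  moveMass : Fin nC → Fin nF → Fin nF → ℚ → (Fin nC → Fin nF → ℚ) → Fin nC → Fin nF → ℚ
  moveMass a i i′ ε x b k = x b k + (if does (b ≟ a) then transfer i i′ ε k else 0ℚ)

  moveMass-rowSum : ∀ a i i′ ε x b → sumF (moveMass a i i′ ε x b) ≡ sumF (x b)
  moveMass-rowSum a i i′ ε x b with does (b ≟ a)
  ... | true  = trans (sumF-+ (x b) (transfer i i′ ε))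
                      (trans (cong (sumF (x b) +_) (sumF-transfer i i′ ε)) (+-identityʳ _))
  ... | false = sumF-cong (λ k → +-identityʳ (x b k))

  moveMass-cost : ∀ a i i′ ε x y →
    cost I (moveMass a i i′ ε x) y ≡ cost I x y + (ε * dist I i a - ε * dist I i′ a)
  moveMass-cost a i i′ ε x y = begin
    F + sumF (λ b → sumF (λ k → moveMass a i i′ ε x b k * dist I k b))
      ≡⟨ cong (F +_) (trans (sumF-cong rowCost) (sumF-+ connection gain)) ⟩
    F + (C + sumF gain)
      ≡⟨ cong (λ e → F + (C + e)) (sumF-at a (λ b → ε * dist I i b - ε * dist I i′ b)) ⟩
    F + (C + (ε * dist I i a - ε * dist I i′ a))
      ≡⟨ +-assoc F C _ ⟨
    cost I x y + (ε * dist I i a - ε * dist I i′ a) ∎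
    where
    open ≡-Reasoning
    connection gain : Fin nC → ℚ
    connection b = sumF (λ k → x b k * dist I k b)
    gain b = if does (b ≟ a) then ε * dist I i b - ε * dist I i′ b else 0ℚ
    F C : ℚ
    F = sumF (λ k → f k * y k)
    C = sumF connection
    rowCost : ∀ b → sumF (λ k → moveMass a i i′ ε x b k * dist I k b) ≡ connection b + gain b
    rowCost b with does (b ≟ a)
    ... | true  = trans (sumF-cong (λ k → *-distribʳ-+ (dist I k b) (x b k) (transfer i i′ ε k)))
                        (trans (sumF-+ (λ k → x b k * dist I k b) (λ k → transfer i i′ ε k * dist I k b))
                               (cong (connection b +_) (sumF-transfer-* i i′ ε (λ k → dist I k b))))
    ... | false = trans (sumF-cong (λ k → cong (_* dist I k b) (+-identityʳ (x b k))))
                        (sym (+-identityʳ _))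

  moveMass-feasible : ∀ {a i i′ ε x y} → Feasible I x y → i ≢ i′ → 0ℚ ≤ ε →
    x a i + ε ≤ y i → ε ≤ x a i′ → Feasible I (moveMass a i i′ ε x) y
  moveMass-feasible {a} {i} {i′} {ε} {x} {y} (rowSum , x≥0 , x≤y , yFeasible)
                    i≢i′ 0≤ε x+ε≤y ε≤x =
    (λ b → trans (moveMass-rowSum a i i′ ε x b) (rowSum b)) ,
    (λ b k → proj₁ (bounds b k)) , (λ b k → proj₂ (bounds b k)) , yFeasible
    where
    x′ = moveMass a i i′ ε x
    bounds : ∀ b k → 0ℚ ≤ x′ b k × x′ b k ≤ y k
    bounds b k with b ≟ a | k ≟ i | k ≟ i′
    ... | no _     | _        | _        rewrite +-identityʳ (x b k) = x≥0 b k , x≤y b k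
    ... | yes refl | yes refl | yes refl = ⊥-elim (i≢i′ refl)
    ... | yes refl | yes refl | no _     rewrite +-identityʳ ε = +-nonneg (x≥0 a i) 0≤ε , x+ε≤y
    ... | yes refl | no _     | yes refl rewrite +-identityˡ (- ε) =
      ≤-trans (≤-reflexive (sym (+-inverseʳ ε))) (+-monoˡ-≤ (- ε) ε≤x) ,
      ≤-trans (+-monoʳ-≤ (x a i′) (neg-antimono-≤ 0≤ε))
              (≤-trans (≤-reflexive (+-identityʳ (x a i′))) (x≤y a i′))
    ... | yes refl | no _     | no _     rewrite +-identityʳ 0ℚ | +-identityʳ (x a k) =
      x≥0 a k , x≤y a k

  optimal⇒nearer-facility-used : ∀ {x y a i i′} → Optimal I x y →
    0ℚ < y i → 0ℚ < x a i′ → dist I i a < dist I i′ a → 0ℚ < x a i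
  optimal⇒nearer-facility-used {x} {y} {a} {i} {i′} (feasible , minimal) 0<yᵢ 0<x dᵢ<dᵢ′
    with 0ℚ <? x a i
  ... | yes 0<xᵢ = 0<xᵢ
  ... | no  0≮xᵢ = ⊥-elim (<-irrefl refl (<-≤-trans cheaper (minimal _ y feasible′)))
    where
    ε = y i ⊓ x a i′
    0<ε : 0ℚ < ε
    0<ε with ⊓-sel (y i) (x a i′)
    ... | inj₁ ε≡yᵢ rewrite ε≡yᵢ = 0<yᵢ
    ... | inj₂ ε≡x  rewrite ε≡x  = 0<x
    x+ε≤y : x a i + ε ≤ y i
    x+ε≤y = ≤-trans (+-monoˡ-≤ ε (≮⇒≥ 0≮xᵢ))
                    (≤-trans (≤-reflexive (+-identityˡ ε)) (p⊓q≤p (y i) (x a i′)))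
    i≢i′ : i ≢ i′
    i≢i′ refl = <-irrefl refl dᵢ<dᵢ′
    feasible′ : Feasible I (moveMass a i i′ ε x) y
    feasible′ = moveMass-feasible feasible i≢i′ (<⇒≤ 0<ε) x+ε≤y (p⊓q≤q (y i) (x a i′))
    cheaper : cost I (moveMass a i i′ ε x) y < cost I x y
    cheaper = begin-strict
      cost I (moveMass a i i′ ε x) y
        ≡⟨ moveMass-cost a i i′ ε x y ⟩
      cost I x y + (ε * dist I i a - ε * dist I i′ a)
        <⟨ +-monoʳ-< (cost I x y) (p<q⇒p-q<0 (*-monoˡ-<-0< 0<ε dᵢ<dᵢ′)) ⟩
      cost I x y + 0ℚ
        ≡⟨ +-identityʳ _ ⟩
      cost I x y ∎
      where open ≤-Reasoning

module ClientQuantities (I : Instance) (x : Fin (Instance.nC I) → Fin (Instance.nF I) → ℚ)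
                        (y : Fin (Instance.nF I) → ℚ)
                        (blk : Fin (Instance.nC I) → Fin (Instance.nF I) → Fin (Instance.r I)) where
  open Instance I
  open Quantities I x y blk

  assignmentCost : Fin nC → ℚ
  assignmentCost a = sumF (mask (inF a) (λ i → y i * dist I i a))

  near far : Fin nC → ℚ → Fin nF → Bool
  near a τ i = inF a i ∧ (dist I i a ≤ᵇ τ)
  far  a τ i = inBlock a lastBlock i ∧ not (dist I i a ≤ᵇ τ)

  dist-nonneg : ∀ i a → 0ℚ ≤ dist I i a
  dist-nonneg i a = d-nonneg (inj₂ i) (inj₁ a)

  y*dist-nonneg : (∀ i → 0ℚ ≤ y i) → ∀ a i → 0ℚ ≤ y i * dist I i a
  y*dist-nonneg 0≤y a i = *-nonneg (0≤y i) (dist-nonneg i a)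

  dCC≤dist+dist : ∀ a b i → dCC I a b ≤ dist I i a + dist I i b
  dCC≤dist+dist a b i = subst (λ e → dCC I a b ≤ e + dist I i b) (d-sym (inj₁ a) (inj₂ i))
                              (d-tri (inj₁ a) (inj₂ i) (inj₁ b))

  inF⇒0<x : ∀ {a i} → inF a i ≡ true → 0ℚ < x a i
  inF⇒0<x inFᵢ = ≤ᵇ≡false⇒> (not-injective inFᵢ)

  0<x⇒inF : ∀ {a i} → 0ℚ < x a i → inF a i ≡ true
  0<x⇒inF {a} {i} 0<x with x a i ≤ᵇ 0ℚ in x≤ᵇ0
  ... | true  = ⊥-elim (<-irrefl refl (<-≤-trans 0<x (≤ᵇ≡true⇒≤ x≤ᵇ0)))
  ... | false = refl

  inBlock⇒ : ∀ {a t i} → inBlock a t i ≡ true → inF a i ≡ true × blk a i ≡ t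
  inBlock⇒ {a} {t} {i} inBlockᵢ =
    ∧-conicalˡ _ _ inBlockᵢ ,
    toWitness {a? = blk a i ≟ t} (subst T (sym (∧-conicalʳ _ _ inBlockᵢ)) tt)

  r*dav≡assignmentCost : ∀ a → ℕ→ℚ r * dav a ≡ assignmentCost a
  r*dav≡assignmentCost a = begin
    ℕ→ℚ r * ((ℤ.+ 1 / r) * assignmentCost a) ≡⟨ *-assoc (ℕ→ℚ r) _ _ ⟨
    (ℕ→ℚ r * (ℤ.+ 1 / r)) * assignmentCost a ≡⟨ cong (_* assignmentCost a) (ℕ→ℚ-suc*1/suc k) ⟩
    1ℚ * assignmentCost a                    ≡⟨ *-identityˡ _ ⟩
    assignmentCost a                         ∎
    where open ≡-Reasoning

  assignmentCost+≤2r*dav⊔ : ∀ a b →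
    assignmentCost a + assignmentCost b ≤ ℕ→ℚ r * (dav a ⊔ dav b) + ℕ→ℚ r * (dav a ⊔ dav b)
  assignmentCost+≤2r*dav⊔ a b = begin
    assignmentCost a + assignmentCost b
      ≡⟨ cong₂ _+_ (r*dav≡assignmentCost a) (r*dav≡assignmentCost b) ⟨
    ℕ→ℚ r * dav a + ℕ→ℚ r * dav b
      ≤⟨ +-mono-≤ (*-monoˡ-≤-0≤ (0≤ℕ→ℚ r) (p≤p⊔q (dav a) (dav b)))
                  (*-monoˡ-≤-0≤ (0≤ℕ→ℚ r) (p≤q⊔p (dav a) (dav b))) ⟩
    ℕ→ℚ r * (dav a ⊔ dav b) + ℕ→ℚ r * (dav a ⊔ dav b) ∎
    where open ≤-Reasoning

  dmax-attained : ∀ a → 0ℚ < dmax a → ∃ λ i → inBlock a lastBlock i ≡ true × dist I i a ≡ dmax a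
  dmax-attained a 0<dmax with maxF-attained (mask (inBlock a lastBlock) (λ i → dist I i a))
  ... | inj₁ dmax≡0 = ⊥-elim (<-irrefl (sym dmax≡0) 0<dmax)
  ... | inj₂ (i , dmax≡) with inBlock a lastBlock i in inBlockᵢ
  ...   | true  = i , inBlockᵢ , sym dmax≡
  ...   | false = ⊥-elim (<-irrefl (sym dmax≡) 0<dmax)

  davT-nonneg : (∀ i → 0ℚ ≤ y i) → ∀ a t → 0ℚ ≤ davT a t
  davT-nonneg 0≤y a t =
    sumF-nonneg (mask-nonneg (inBlock a t) (y*dist-nonneg 0≤y a))

  dav-nonneg : (∀ i → 0ℚ ≤ y i) → ∀ a → 0ℚ ≤ dav a
  dav-nonneg 0≤y a = *-nonneg (nonNegative⁻¹ (ℤ.+ 1 / r) {{normalize-nonNeg 1 r}})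
    (sumF-nonneg (mask-nonneg (inF a) (y*dist-nonneg 0≤y a)))

  far-markov : (∀ i → 0ℚ ≤ y i) → ∀ a τ → τ * sumF (mask (far a τ) y) ≤ davT a lastBlock
  far-markov 0≤y a τ =
    ≤-trans (sumF-mask-scale τ y τy≤yd)
            (sumF-mask-⊆ (y*dist-nonneg 0≤y a) (λ i → ∧-conicalˡ _ _))
    where
    τy≤yd : ∀ i → far a τ i ≡ true → τ * y i ≤ y i * dist I i a
    τy≤yd i farᵢ = ≤-trans (≤-reflexive (*-comm τ (y i)))
      (*-monoˡ-≤-0≤ (0≤y i) (<⇒≤ (≤ᵇ≡false⇒> (not-injective (∧-conicalʳ _ _ farᵢ)))))

  sharedMass-bound : (∀ i → 0ℚ ≤ y i) → ∀ {s} a b →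
    (∀ i → s i ≡ true → inF a i ≡ true × inF b i ≡ true) →
    dCC I a b * sumF (mask s y) ≤ assignmentCost a + assignmentCost b
  sharedMass-bound 0≤y {s} a b s⊆F = begin
    dCC I a b * sumF (mask s y)
      ≤⟨ sumF-mask-scale (dCC I a b) y (λ i _ → D*y≤ i) ⟩
    sumF (mask s (λ i → y i * dist I i a + y i * dist I i b))
      ≡⟨ sumF-mask-+ s (λ i → y i * dist I i a) (λ i → y i * dist I i b) ⟩
    sumF (mask s (λ i → y i * dist I i a)) + sumF (mask s (λ i → y i * dist I i b))
      ≤⟨ +-mono-≤ (sumF-mask-⊆ (y*dist-nonneg 0≤y a) (λ i → proj₁ ∘ s⊆F i))
                  (sumF-mask-⊆ (y*dist-nonneg 0≤y b) (λ i → proj₂ ∘ s⊆F i)) ⟩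
    assignmentCost a + assignmentCost b ∎
    where
    open ≤-Reasoning
    D*y≤ : ∀ i → dCC I a b * y i ≤ y i * dist I i a + y i * dist I i b
    D*y≤ i = begin
      dCC I a b * y i                   ≡⟨ *-comm (dCC I a b) (y i) ⟩
      y i * dCC I a b                   ≤⟨ *-monoˡ-≤-0≤ (0≤y i) (dCC≤dist+dist a b i) ⟩
      y i * (dist I i a + dist I i b)   ≡⟨ *-distribˡ-+ (y i) (dist I i a) (dist I i b) ⟩
      y i * dist I i a + y i * dist I i b ∎

  sumF-mask-inF≡r : Feasible I x y → (∀ j i → x j i ≡ 0ℚ ⊎ x j i ≡ y i) →
    ∀ a → sumF (mask (inF a) y) ≡ ℕ→ℚ r
  sumF-mask-inF≡r (rowSum , x≥0 , _) x∈0y a = trans (sumF-cong mask≡x) (rowSum a)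
    where
    mask≡x : ∀ i → mask (inF a) y i ≡ x a i
    mask≡x i with inF a i in inFᵢ | x∈0y a i
    ... | true  | inj₁ x≡0 = ⊥-elim (<-irrefl (sym x≡0) (inF⇒0<x inFᵢ))
    ... | true  | inj₂ x≡y = sym x≡y
    ... | false | _        = ≤-antisym (x≥0 a i) (≤ᵇ≡true⇒≤ (not-injective inFᵢ))

  dist≤davT-last : (∀ i → 0ℚ ≤ y i) → ValidBlocks → ∀ {a i} → inF a i ≡ true →
    blk a i ≢ lastBlock → dist I i a ≤ davT a lastBlock
  dist≤davT-last 0≤y (unitMass , ordered) {a} {i} inFᵢ ≢last = begin
    dist I i a                                       ≡⟨ *-identityʳ _ ⟨
    dist I i a * 1ℚ                                  ≡⟨ cong (dist I i a *_) (unitMass a lastBlock) ⟨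
    dist I i a * sumF (mask (inBlock a lastBlock) y) ≤⟨ sumF-mask-scale (dist I i a) y d*y≤ ⟩
    davT a lastBlock                                 ∎
    where
    open ≤-Reasoning
    d*y≤ : ∀ i′ → inBlock a lastBlock i′ ≡ true → dist I i a * y i′ ≤ y i′ * dist I i′ a
    d*y≤ i′ inBlockᵢ′ with inBlock⇒ inBlockᵢ′
    ... | inFᵢ′ , blk≡last = ≤-trans (≤-reflexive (*-comm (dist I i a) (y i′)))
      (*-monoˡ-≤-0≤ (0≤y i′) (ordered a i i′ inFᵢ inFᵢ′
        (subst (blk a i Fin.<_) (sym blk≡last) (≤∧≢⇒< (≤fromℕ (blk a i)) ≢last))))

  r≤near+far : Feasible I x y → (∀ j i → x j i ≡ 0ℚ ⊎ x j i ≡ y i) → ValidBlocks →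
    ∀ a {τ} → davT a lastBlock < τ →
    ℕ→ℚ r ≤ sumF (mask (near a τ) y) + sumF (mask (far a τ) y)
  r≤near+far feasible@(_ , _ , _ , 0≤y , _) x∈0y vb a {τ} davT<τ =
    subst (_≤ sumF (mask (near a τ) y) + sumF (mask (far a τ) y))
          (sumF-mask-inF≡r feasible x∈0y a) (sumF-mask-cover 0≤y covered)
    where
    covered : ∀ i → inF a i ≡ true → near a τ i ≡ true ⊎ far a τ i ≡ true
    covered i inFᵢ rewrite inFᵢ with dist I i a ≤ᵇ τ in dᵢ≤ᵇτ | blk a i ≟ lastBlock
    ... | true  | _        = inj₁ refl
    ... | false | yes _    = inj₂ refl
    ... | false | no ≢last = ⊥-elim (subst T dᵢ≤ᵇτ
      (≤⇒≤ᵇ (<⇒≤ (≤-<-trans (dist≤davT-last 0≤y vb inFᵢ ≢last) davT<τ))))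

module Filtering (I : Instance) (x : Fin (Instance.nC I) → Fin (Instance.nF I) → ℚ)
                 (y : Fin (Instance.nF I) → ℚ)
                 (blk : Fin (Instance.nC I) → Fin (Instance.nF I) → Fin (Instance.r I)) (δ : ℚ) where
  open Instance I
  open Quantities I x y blk
  open Filter δ

  NonConflicting : Fin nC → Fin nC → Set
  NonConflicting a b = ¬ T (conflict a b)

  nonConflicting-sym : Symmetric NonConflicting
  nonConflicting-sym {a} {b} nc = nc ∘ subst T conflict-sym
    where
    conflict-sym : conflict b a ≡ conflict a b
    conflict-sym = cong₂ (λ d m → d ≤ᵇ ℕ→ℚ 6 * m)
                         (d-sym (inj₁ b) (inj₁ a)) (⊔-comm (dav b) (dav a))

  greedy-⊆ : ∀ sel js {j} → j ∈ greedy sel js → j ∈ sel ⊎ j ∈ js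
  greedy-⊆ sel []       j∈ = inj₁ j∈
  greedy-⊆ sel (a ∷ js) j∈ with any (conflict a) sel
  ... | true  = Sum.map₂ there (greedy-⊆ sel js j∈)
  ... | false with greedy-⊆ (a ∷ sel) js j∈
  ...   | inj₁ (here j≡a)    = inj₂ (here j≡a)
  ...   | inj₁ (there j∈sel) = inj₁ j∈sel
  ...   | inj₂ j∈js          = inj₂ (there j∈js)

  greedy-nonConflicting : ∀ sel js → AllPairs NonConflicting sel →
    AllPairs NonConflicting (greedy sel js)
  greedy-nonConflicting sel []       ok = ok
  greedy-nonConflicting sel (a ∷ js) ok with any (conflict a) sel in anyConflict
  ... | true  = greedy-nonConflicting sel js ok
  ... | false = greedy-nonConflicting (a ∷ sel) js
      (¬Any⇒All¬ sel (λ conflicting → subst T anyConflict (any⁺ (conflict a) conflicting)) ∷ ok)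

module _ {δ : ℚ} (δ>0 : 0ℚ < δ) where
  γ-positive : Positive (ℕ→ℚ 3 + δ)
  γ-positive = pos+pos⇒pos (ℕ→ℚ 3) δ {{positive δ>0}}

  0<γ : 0ℚ < ℕ→ℚ 3 + δ
  0<γ = positive⁻¹ (ℕ→ℚ 3 + δ) {{γ-positive}}

  0<γ⁻¹ : 0ℚ < γ⁻¹ δ δ>0
  0<γ⁻¹ = positive⁻¹ (γ⁻¹ δ δ>0) {{1/pos⇒pos (ℕ→ℚ 3 + δ) {{γ-positive}}}}

  γ⁻¹*γ≡1 : γ⁻¹ δ δ>0 * (ℕ→ℚ 3 + δ) ≡ 1ℚ
  γ⁻¹*γ≡1 = *-inverseˡ (ℕ→ℚ 3 + δ) {{pos⇒nonZero (ℕ→ℚ 3 + δ) {{γ-positive}}}}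

module Separation (I : Instance) (x : Fin (Instance.nC I) → Fin (Instance.nF I) → ℚ)
                  (y : Fin (Instance.nF I) → ℚ) (opt : Optimal I x y)
                  (x∈0y : ∀ j i → x j i ≡ 0ℚ ⊎ x j i ≡ y i)
                  (blk : Fin (Instance.nC I) → Fin (Instance.nF I) → Fin (Instance.r I))
                  (vb : Quantities.ValidBlocks I x y blk) {δ : ℚ} (δ>0 : 0ℚ < δ) where
  open Instance I
  open Quantities I x y blk
  open Filter δ
  open ClientQuantities I x y blk
  open Filtering I x y blk δ

  private
    feasible : Feasible I x y
    feasible = proj₁ opt

    x≤y : ∀ j i → x j i ≤ y i
    x≤y = proj₁ (proj₂ (proj₂ feasible))

    0≤y : ∀ i → 0ℚ ≤ y i
    0≤y = proj₁ (proj₂ (proj₂ (proj₂ feasible)))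

  dangerous⇒3davT<γ⁻¹dmax : ∀ {a} → dangerous a ≡ true →
    ℕ→ℚ 3 * davT a lastBlock < γ⁻¹ δ δ>0 * dmax a
  dangerous⇒3davT<γ⁻¹dmax {a} dangerousₐ = begin-strict
    ℕ→ℚ 3 * Tᵣ
      ≡⟨ *-identityˡ _ ⟨
    1ℚ * (ℕ→ℚ 3 * Tᵣ)
      ≡⟨ cong (_* (ℕ→ℚ 3 * Tᵣ)) (γ⁻¹*γ≡1 δ>0) ⟨
    (g * γ) * (ℕ→ℚ 3 * Tᵣ)
      ≡⟨ solve 4 (λ g γ t T → (g :* γ) :* (t :* T) := g :* ((t :* γ) :* T)) refl g γ (ℕ→ℚ 3) Tᵣ ⟩
    g * ((ℕ→ℚ 3 * γ) * Tᵣ)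
      <⟨ *-monoˡ-<-0< (0<γ⁻¹ δ>0) (≤ᵇ≡false⇒> (not-injective dangerousₐ)) ⟩
    g * dmax a ∎
    where
    open ≤-Reasoning
    g = γ⁻¹ δ δ>0
    Tᵣ = davT a lastBlock

  dangerous⇒0<dmax : ∀ {a} → dangerous a ≡ true → 0ℚ < dmax a
  dangerous⇒0<dmax {a} dangerousₐ =
    ≤-<-trans (*-nonneg (*-nonneg (0≤ℕ→ℚ 3) (<⇒≤ (0<γ δ>0))) (davT-nonneg 0≤y a lastBlock))
              (≤ᵇ≡false⇒> (not-injective dangerousₐ))

  near-shared : ∀ {j j′ τ} → dangerous j ≡ true → dCC I j j′ < dmax j - τ →
    ∀ i → near j′ τ i ≡ true → inF j i ≡ true × inF j′ i ≡ true
  near-shared {j} {j′} {τ} dangerousⱼ gap i nearᵢ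
    with dmax-attained j (dangerous⇒0<dmax dangerousⱼ)
  ... | i* , inBlockᵢ* , dᵢ*≡dmax =
    0<x⇒inF (optimal⇒nearer-facility-used I opt 0<yᵢ 0<xᵢ* closer) , inFⱼ′ᵢ
    where
    inFⱼ′ᵢ = ∧-conicalˡ (inF j′ i) (dist I i j′ ≤ᵇ τ) nearᵢ
    dᵢ≤τ = ≤ᵇ≡true⇒≤ {dist I i j′} {τ} (∧-conicalʳ (inF j′ i) (dist I i j′ ≤ᵇ τ) nearᵢ)
    0<xᵢ* = inF⇒0<x (proj₁ (inBlock⇒ inBlockᵢ*))
    0<yᵢ = <-≤-trans (inF⇒0<x inFⱼ′ᵢ) (x≤y j′ i)
    closer : dist I i j < dist I i* j
    closer = begin-strict
      dist I i j                ≤⟨ d-tri (inj₂ i) (inj₁ j′) (inj₁ j) ⟩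
      dist I i j′ + dCC I j′ j  ≡⟨ cong (dist I i j′ +_) (d-sym (inj₁ j′) (inj₁ j)) ⟩
      dist I i j′ + dCC I j j′  ≤⟨ +-monoˡ-≤ (dCC I j j′) dᵢ≤τ ⟩
      τ + dCC I j j′            <⟨ p<q-r⇒r+p<q gap ⟩
      dmax j                    ≡⟨ dᵢ*≡dmax ⟨
      dist I i* j               ∎
      where open ≤-Reasoning

  dmax-gap : ∀ {j j′} → dangerous j ≡ true → dangerous j′ ≡ true → NonConflicting j j′ →
    dmax j - γ⁻¹ δ δ>0 * dmax j′ ≤ dCC I j j′
  dmax-gap {j} {j′} dangerousⱼ dangerousⱼ′ nc = ≮⇒≥ λ gap →
    mass-budget-contradiction {D = dCC I j j′}
      {s = sumF (mask (near j′ τ) y)} {b = sumF (mask (far j′ τ) y)}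
      (1≤ℕ→ℚ-suc k) (≤-trans (dav-nonneg 0≤y j) (p≤p⊔q _ _))
      (≰⇒> (nc ∘ ≤⇒≤ᵇ))
      (r≤near+far feasible x∈0y vb j′ (≤-<-trans (0≤p⇒p≤3p (davT-nonneg 0≤y j′ lastBlock)) 3T<τ))
      (τb≤T∧3T<τ⇒3b<1 0≤τ (far-markov 0≤y j′ τ) 3T<τ)
      (≤-trans (sharedMass-bound 0≤y j j′ (near-shared dangerousⱼ gap))
               (assignmentCost+≤2r*dav⊔ j j′))
    where
    τ = γ⁻¹ δ δ>0 * dmax j′
    3T<τ : ℕ→ℚ 3 * davT j′ lastBlock < τ
    3T<τ = dangerous⇒3davT<γ⁻¹dmax dangerousⱼ′
    0≤τ : 0ℚ ≤ τ
    0≤τ = *-nonneg (<⇒≤ (0<γ⁻¹ δ>0)) (<⇒≤ (dangerous⇒0<dmax dangerousⱼ′))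

lemma1 : (I : Instance)
  (x : Fin (Instance.nC I) → Fin (Instance.nF I) → ℚ)
  (y : Fin (Instance.nF I) → ℚ) →
  Optimal I x y →
  (∀ j i → x j i ≡ 0ℚ ⊎ x j i ≡ y i) →
  (blk : Fin (Instance.nC I) → Fin (Instance.nF I) → Fin (Instance.r I)) →
  Quantities.ValidBlocks I x y blk →
  (δ : ℚ) (δ>0 : 0ℚ < δ) →
  (order : List (Fin (Instance.nC I))) →
  (∀ j → (j ∈ order → Quantities.Filter.dangerous I x y blk δ j ≡ true)
       × (Quantities.Filter.dangerous I x y blk δ j ≡ true → j ∈ order)) →
  Unique order →
  AllPairs (λ a b → Quantities.dav I x y blk a ≤ Quantities.dav I x y blk b) order →
  ∀ j j' →
  j ∈ Quantities.Filter.D' I x y blk δ order →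
  j' ∈ Quantities.Filter.D' I x y blk δ order →
  j ≢ j' →
  (Quantities.dmax I x y blk j ⊔ Quantities.dmax I x y blk j')
    - γ⁻¹ δ δ>0 * (Quantities.dmax I x y blk j ⊓ Quantities.dmax I x y blk j')
    ≤ dCC I j j'
lemma1 I x y opt x∈0y blk vb δ δ>0 order order-spec _ _ j j′ j∈D′ j′∈D′ j≢j′ =
  ⊔-minus-⊓-≤ (γ⁻¹ δ δ>0) (dmax j) (dmax j′)
    (dmax-gap (dangerous-∈D′ j∈D′) (dangerous-∈D′ j′∈D′) nc)
    (subst (dmax j′ - γ⁻¹ δ δ>0 * dmax j ≤_) (d-sym (inj₁ j′) (inj₁ j))
      (dmax-gap (dangerous-∈D′ j′∈D′) (dangerous-∈D′ j∈D′) (nonConflicting-sym nc)))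
  where
  open Instance I
  open Quantities I x y blk
  open Filter δ
  open Filtering I x y blk δ
  open Separation I x y opt x∈0y blk vb δ>0

  dangerous-∈D′ : ∀ {a} → a ∈ D' order → dangerous a ≡ true
  dangerous-∈D′ a∈D′ with greedy-⊆ [] order a∈D′
  ... | inj₁ ()
  ... | inj₂ a∈order = proj₁ (order-spec _) a∈order

  nc : NonConflicting j j′
  nc = allPairs-lookup nonConflicting-sym (greedy-nonConflicting [] order []) j∈D′ j′∈D′ j≢j′
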